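{- For a block-colored tensor $T$, $\chi(T)\le \chi(\mathrm{Out}(T))\cdot\max_{T'\in\mathrm{Inn}(T)}\chi(T')$.
   Context: A colored tensor is a pair $(I,P)$ with $P\subset A\times B\times C$ (the support of a $\{0,1\}$-valued tensor) and $I\subset P$ (the "green" terms). With $\pi_1,\pi_2,\pi_3$ the coordinate projections, $S\subset I$ is independent if each element of $\pi_1(S)$ (resp. $\pi_2(S)$, $\pi_3(S)$) lies in exactly one triple of $S$ and $P\cap(\pi_1(S)\times\pi_2(S)\times\pi_3(S))=S$. $\chi(I,P)$ is the least $k$ such that there is $\tau:I\to[k]$ with every color class independent. For an ordinary tensor $P$, $\chi(P):=\chi(P,P)$. A block-colored tensor is a colored tensor $(I,P)$ over $A\times B\times C$ together with partitions $A=A_1\cup\dots\cup A_p$, $B=B_1\cup\dots\cup B_q$, $C=C_1\cup\dots\cup C_r$. Its outer structure $\mathrm{Out}(T)$ is the tensor over $[p]\times[q]\times[r]$ with $(i,j,k)$ in the support iff $P\cap(A_i\times B_j\times C_k)\neq\emptyset$. Its inner structure $\mathrm{Inn}(T)$ is the collection of colored tensors $(I\cap(A_i\times B_j\times C_k),\,P\cap(A_i\times B_j\times C_k))$. -}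

module Defs where

open import Data.Nat using (ℕ; zero; suc; _⊔_; _≤_)
open import Data.Fin using (Fin; zero; suc)
open import Data.Product using (Σ; ∃; _×_; _,_; proj₁; proj₂)
open import Relation.Binary.PropositionalEquality using (_≡_)
open import Function using (_∘_)

Triple : ℕ → ℕ → ℕ → Set
Triple a b c = Fin a × Fin b × Fin c

π₁ : ∀ {a b c} → Triple a b c → Fin a
π₁ (x , _ , _) = x

π₂ : ∀ {a b c} → Triple a b c → Fin b
π₂ (_ , y , _) = y

π₃ : ∀ {a b c} → Triple a b c → Fin c
π₃ (_ , _ , z) = z

TSubset : ℕ → ℕ → ℕ → Set₁
TSubset a b c = Triple a b c → Set

record ColoredTensor (a b c : ℕ) : Set₁ where
  field
    P   : TSubset a b c
    I   : TSubset a b c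
    I⊆P : ∀ t → I t → P t
open ColoredTensor public

plain : ∀ {a b c} → TSubset a b c → ColoredTensor a b c
plain Q = record { P = Q ; I = Q ; I⊆P = λ _ q → q }

-- S is independent w.r.t. the support P:
-- each element of π_i(S) lies in exactly one triple of S, and
-- P ∩ (π₁(S) × π₂(S) × π₃(S)) = S  (the inclusion S ⊆ P holds since S ⊆ I ⊆ P).
Independent : ∀ {a b c} → TSubset a b c → TSubset a b c → Set
Independent {a} {b} {c} Q S =
    (∀ s s' → S s → S s' → π₁ s ≡ π₁ s' → s ≡ s')
  × (∀ s s' → S s → S s' → π₂ s ≡ π₂ s' → s ≡ s')
  × (∀ s s' → S s → S s' → π₃ s ≡ π₃ s' → s ≡ s')
  × (∀ (t : Triple a b c) → Q t
       → (∃ λ s → S s × π₁ s ≡ π₁ t)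
       → (∃ λ s → S s × π₂ s ≡ π₂ t)
       → (∃ λ s → S s × π₃ s ≡ π₃ t)
       → S t)

-- τ : I → [k] (values of τ outside I are irrelevant);
-- valid iff every colour class {t ∈ I | τ t = col} is independent.
ValidColoring : ∀ {a b c} (T : ColoredTensor a b c) (k : ℕ) → (Triple a b c → Fin k) → Set
ValidColoring T k τ = ∀ (col : Fin k) → Independent (P T) (λ t → I T t × τ t ≡ col)

Colorable : ∀ {a b c} → ColoredTensor a b c → ℕ → Set
Colorable {a} {b} {c} T k = Σ (Triple a b c → Fin k) (ValidColoring T k)

IsChi : ∀ {a b c} → ColoredTensor a b c → ℕ → Set
IsChi T n = Colorable T n × (∀ m → Colorable T m → n ≤ m)

-- A block-colored tensor: colored tensor plus partitions of A, B, C
-- into p, q, r (nonempty) parts, given by surjective part-index maps.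
record BlockColoredTensor (a b c : ℕ) : Set₁ where
  field
    tensor : ColoredTensor a b c
    p q r  : ℕ
    α      : Fin a → Fin p
    β      : Fin b → Fin q
    γ      : Fin c → Fin r
    α-onto : ∀ i → ∃ λ x → α x ≡ i
    β-onto : ∀ j → ∃ λ y → β y ≡ j
    γ-onto : ∀ k → ∃ λ z → γ z ≡ k
open BlockColoredTensor public

InBlock : ∀ {a b c} (T : BlockColoredTensor a b c) →
          Fin (p T) → Fin (q T) → Fin (r T) → TSubset a b c
InBlock T i j k t = α T (π₁ t) ≡ i × β T (π₂ t) ≡ j × γ T (π₃ t) ≡ k

Out : ∀ {a b c} (T : BlockColoredTensor a b c) → ColoredTensor (p T) (q T) (r T)
Out {a} {b} {c} T = plain (λ u →
  ∃ λ (t : Triple a b c) → P (tensor T) t × InBlock T (π₁ u) (π₂ u) (π₃ u) t)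

-- Inner block (I ∩ (A_i×B_j×C_k), P ∩ (A_i×B_j×C_k)), represented over the
-- full ground set A×B×C (entries outside the block are 0).
Inn : ∀ {a b c} (T : BlockColoredTensor a b c) →
      Fin (p T) → Fin (q T) → Fin (r T) → ColoredTensor a b c
Inn T i j k = record
  { P   = λ t → P (tensor T) t × InBlock T i j k t
  ; I   = λ t → I (tensor T) t × InBlock T i j k t
  ; I⊆P = λ t h → I⊆P (tensor T) t (proj₁ h) , proj₂ h
  }

maxFin : ∀ n → (Fin n → ℕ) → ℕ
maxFin zero    f = 0
maxFin (suc n) f = f zero ⊔ maxFin n (f ∘ suc)

max3 : ∀ p q r → (Fin p → Fin q → Fin r → ℕ) → ℕ
max3 p q r f = maxFin p (λ i → maxFin q (λ j → maxFin r (λ k → f i j k)))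

-- Colour a green term t by the pair (σ(block of t), τ_block(t)) of an outer and an inner colour,
-- all inner colours read in one palette of size max χ(Inn). A colour class lies over one outer
-- class O and meets each block of O in one inner class. Two of its terms sharing a coordinate lie
-- in blocks of O sharing that coordinate, hence in the same block, and then coincide by inner
-- independence; closure follows from closure of O on blocks and then closure inside the block.
module Submission where

open import Defs
open import Data.Nat using (ℕ; _≤_; _*_; suc)
open import Data.Nat.Properties using (≤-trans; m≤m⊔n; m≤n⊔m)
open import Data.Fin using (Fin; zero; suc; toℕ; inject≤; combine; remQuot)
open import Data.Fin.Properties using (toℕ-injective; toℕ-inject≤; combine-injective; remQuot-combine)
open import Data.Product using (∃; _×_; _,_; proj₁; proj₂)
open import Data.Product.Properties using (,-injective)
open import Function using (_∘_)
open import Relation.Binary.PropositionalEquality using (_≡_; refl; sym; trans; cong; cong₂; subst; module ≡-Reasoning)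
open import Relation.Unary using (_≐_)

≤maxFin : ∀ n (f : Fin n → ℕ) i → f i ≤ maxFin n f
≤maxFin (suc n) f zero    = m≤m⊔n (f zero) _
≤maxFin (suc n) f (suc i) = ≤-trans (≤maxFin n (f ∘ suc) i) (m≤n⊔m (f zero) _)

≤max3 : ∀ p q r (f : Fin p → Fin q → Fin r → ℕ) i j k → f i j k ≤ max3 p q r f
≤max3 p q r f i j k =
  ≤-trans (≤maxFin r (f i j) k)
    (≤-trans (≤maxFin q (λ j → maxFin r (f i j)) j)
      (≤maxFin p (λ i → maxFin q (λ j → maxFin r (f i j))) i))

Independent-resp : ∀ {a b c} {Q S S′ : TSubset a b c} →
                   S ≐ S′ → Independent Q S → Independent Q S′
Independent-resp {Q = Q} {S′ = S′} (to , from) (unique₁ , unique₂ , unique₃ , closed) =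
  unique₁′ , unique₂′ , unique₃′ , closed′
  where
  unique₁′ : ∀ s s′ → S′ s → S′ s′ → π₁ s ≡ π₁ s′ → s ≡ s′
  unique₁′ s s′ h h′ = unique₁ s s′ (from h) (from h′)
  unique₂′ : ∀ s s′ → S′ s → S′ s′ → π₂ s ≡ π₂ s′ → s ≡ s′
  unique₂′ s s′ h h′ = unique₂ s s′ (from h) (from h′)
  unique₃′ : ∀ s s′ → S′ s → S′ s′ → π₃ s ≡ π₃ s′ → s ≡ s′
  unique₃′ s s′ h h′ = unique₃ s s′ (from h) (from h′)
  closed′ : ∀ t → Q t → (∃ λ s → S′ s × π₁ s ≡ π₁ t) → (∃ λ s → S′ s × π₂ s ≡ π₂ t)
            → (∃ λ s → S′ s × π₃ s ≡ π₃ t) → S′ t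
  closed′ t Qt (s₁ , h₁ , e₁) (s₂ , h₂ , e₂) (s₃ , h₃ , e₃) =
    to (closed t Qt (s₁ , from h₁ , e₁) (s₂ , from h₂ , e₂) (s₃ , from h₃ , e₃))

module _ {a b c} (T : BlockColoredTensor a b c) where

  Block : Set
  Block = Triple (p T) (q T) (r T)

  blockOf : Triple a b c → Block
  blockOf t = α T (π₁ t) , β T (π₂ t) , γ T (π₃ t)

  InBlockAt : Block → TSubset a b c
  InBlockAt u = InBlock T (π₁ u) (π₂ u) (π₃ u)

  inBlockAt-blockOf : ∀ t → InBlockAt (blockOf t) t
  inBlockAt-blockOf t = refl , refl , refl

  inBlockAt⇒blockOf : ∀ {u t} → InBlockAt u t → blockOf t ≡ u
  inBlockAt⇒blockOf (refl , refl , refl) = refl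

  inBlockAt-resp : ∀ {u u′ t} → u ≡ u′ → InBlockAt u t → InBlockAt u′ t
  inBlockAt-resp {t = t} e = subst (λ v → InBlockAt v t) e

  independent-glue : ∀ {O : TSubset (p T) (q T) (r T)} {S : TSubset a b c} →
    Independent (P (Out T)) O →
    (∀ {s} → S s → O (blockOf s)) →
    (∀ u → (∃ λ s → S s × InBlockAt u s) →
      Independent (P (Inn T (π₁ u) (π₂ u) (π₃ u))) (λ t → S t × InBlockAt u t)) →
    Independent (P (tensor T)) S
  independent-glue {O} {S} (outer₁ , outer₂ , outer₃ , outerClosed) S⇒O inner =
    unique (cong (α T)) outer₁ (λ u h → proj₁ (inner u h)) ,
    unique (cong (β T)) outer₂ (λ u h → proj₁ (proj₂ (inner u h))) ,
    unique (cong (γ T)) outer₃ (λ u h → proj₁ (proj₂ (proj₂ (inner u h)))) ,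
    closed
    where
    InnerClass : Block → TSubset a b c
    InnerClass u t = S t × InBlockAt u t

    unique : ∀ {X Y : Set} {πO : Block → Y} {πI : Triple a b c → X} →
      (∀ {s s′} → πI s ≡ πI s′ → πO (blockOf s) ≡ πO (blockOf s′)) →
      (∀ u u′ → O u → O u′ → πO u ≡ πO u′ → u ≡ u′) →
      (∀ u → (∃ λ s → InnerClass u s) →
        ∀ t t′ → InnerClass u t → InnerClass u t′ → πI t ≡ πI t′ → t ≡ t′) →
      ∀ s s′ → S s → S s′ → πI s ≡ πI s′ → s ≡ s′
    unique toBlocks outerUnique innerUnique s s′ Ss Ss′ e =
      innerUnique (blockOf s) (s , Ss∈) s s′ Ss∈ (Ss′ , inBlockAt-resp (sym sameBlock) (inBlockAt-blockOf s′)) e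
      where
      Ss∈ : InnerClass (blockOf s) s
      Ss∈ = Ss , inBlockAt-blockOf s
      sameBlock : blockOf s ≡ blockOf s′
      sameBlock = outerUnique _ _ (S⇒O Ss) (S⇒O Ss′) (toBlocks e)

    closed : ∀ t → P (tensor T) t → (∃ λ s → S s × π₁ s ≡ π₁ t) → (∃ λ s → S s × π₂ s ≡ π₂ t)
             → (∃ λ s → S s × π₃ s ≡ π₃ t) → S t
    closed t Pt (s₁ , S₁ , e₁) (s₂ , S₂ , e₂) (s₃ , S₃ , e₃) =
      proj₁ (proj₂ (proj₂ (proj₂ (inner u (s₁ , S₁∈)))) t (Pt , inBlockAt-blockOf t)
        (s₁ , S₁∈ , e₁)
        (s₂ , (S₂ , inBlockAt-resp b₂ (inBlockAt-blockOf s₂)) , e₂)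
        (s₃ , (S₃ , inBlockAt-resp b₃ (inBlockAt-blockOf s₃)) , e₃))
      where
      u : Block
      u = blockOf t
      Ou : O u
      Ou = outerClosed u (t , Pt , inBlockAt-blockOf t)
             (blockOf s₁ , S⇒O S₁ , cong (α T) e₁)
             (blockOf s₂ , S⇒O S₂ , cong (β T) e₂)
             (blockOf s₃ , S⇒O S₃ , cong (γ T) e₃)
      b₁ : blockOf s₁ ≡ u
      b₁ = outer₁ _ _ (S⇒O S₁) Ou (cong (α T) e₁)
      b₂ : blockOf s₂ ≡ u
      b₂ = outer₂ _ _ (S⇒O S₂) Ou (cong (β T) e₂)
      b₃ : blockOf s₃ ≡ u
      b₃ = outer₃ _ _ (S⇒O S₃) Ou (cong (γ T) e₃)
      S₁∈ : InnerClass u s₁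
      S₁∈ = S₁ , inBlockAt-resp b₁ (inBlockAt-blockOf s₁)

module ProductColoring {a b c} (T : BlockColoredTensor a b c)
  {m} (σ : Block T → Fin m) (σ-valid : ValidColoring (Out T) m σ)
  {χI : Fin (p T) → Fin (q T) → Fin (r T) → ℕ}
  (τ : ∀ i j k → Triple a b c → Fin (χI i j k))
  (τ-valid : ∀ i j k → ValidColoring (Inn T i j k) (χI i j k) (τ i j k))
  {n} (χI≤n : ∀ i j k → χI i j k ≤ n) where

  τAt : (u : Block T) → Triple a b c → Fin (χI (π₁ u) (π₂ u) (π₃ u))
  τAt u = τ (π₁ u) (π₂ u) (π₃ u)

  innerColor : Triple a b c → Fin n
  innerColor t = inject≤ (τAt u t) (χI≤n (π₁ u) (π₂ u) (π₃ u))
    where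
    u : Block T
    u = blockOf T t

  productColor : Triple a b c → Fin (m * n)
  productColor t = combine (σ (blockOf T t)) (innerColor t)

  toℕ-innerColor : ∀ {u} t → blockOf T t ≡ u → toℕ (innerColor t) ≡ toℕ (τAt u t)
  toℕ-innerColor t refl = toℕ-inject≤ _ _

  innerColor≡⇒τAt≡ : ∀ {u s t} → blockOf T s ≡ u → blockOf T t ≡ u →
                     innerColor s ≡ innerColor t → τAt u s ≡ τAt u t
  innerColor≡⇒τAt≡ {s = s} {t} bs bt e = toℕ-injective (begin
    toℕ (τAt _ s)     ≡⟨ sym (toℕ-innerColor s bs) ⟩
    toℕ (innerColor s) ≡⟨ cong toℕ e ⟩
    toℕ (innerColor t) ≡⟨ toℕ-innerColor t bt ⟩
    toℕ (τAt _ t)     ∎)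
    where open ≡-Reasoning

  τAt≡⇒innerColor≡ : ∀ {u s t} → blockOf T s ≡ u → blockOf T t ≡ u →
                     τAt u s ≡ τAt u t → innerColor s ≡ innerColor t
  τAt≡⇒innerColor≡ {s = s} {t} bs bt e = toℕ-injective (begin
    toℕ (innerColor s) ≡⟨ toℕ-innerColor s bs ⟩
    toℕ (τAt _ s)     ≡⟨ cong toℕ e ⟩
    toℕ (τAt _ t)     ≡⟨ toℕ-innerColor t bt ⟨
    toℕ (innerColor t) ∎)
    where open ≡-Reasoning

  productColor≡⇒innerColor≡ : ∀ {s t} → productColor s ≡ productColor t → innerColor s ≡ innerColor t
  productColor≡⇒innerColor≡ {s} {t} =
    proj₂ ∘ combine-injective (σ (blockOf T s)) (innerColor s) (σ (blockOf T t)) (innerColor t)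

  productColor-valid : ValidColoring (tensor T) (m * n) productColor
  productColor-valid col = independent-glue T (σ-valid outerColor) sameOuterColor innerTrace
    where
    S : TSubset a b c
    S t = I (tensor T) t × productColor t ≡ col

    outerColor : Fin m
    outerColor = proj₁ (remQuot n col)

    sameOuterColor : ∀ {s} → S s → I (Out T) (blockOf T s) × σ (blockOf T s) ≡ outerColor
    sameOuterColor {s} (Is , e) =
      (s , I⊆P (tensor T) s Is , inBlockAt-blockOf T s) ,
      proj₁ (,-injective (trans (sym (remQuot-combine _ _)) (cong (remQuot n) e)))

    innerTrace : ∀ u → (∃ λ s → S s × InBlockAt T u s) →
      Independent (P (Inn T (π₁ u) (π₂ u) (π₃ u))) (λ t → S t × InBlockAt T u t)
    -- The inner colour of the trace is only known through a witness s₀ (the class may be empty).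
    innerTrace u (s₀ , (_ , e₀) , s₀∈u) =
      Independent-resp (to , from) (τ-valid (π₁ u) (π₂ u) (π₃ u) (τAt u s₀))
      where
      b₀ : blockOf T s₀ ≡ u
      b₀ = inBlockAt⇒blockOf T s₀∈u
      to : ∀ {t} → (I (tensor T) t × InBlockAt T u t) × τAt u t ≡ τAt u s₀ → S t × InBlockAt T u t
      to {t} ((It , t∈u) , e) =
        (It , trans (cong₂ combine (cong σ (trans bt (sym b₀))) (τAt≡⇒innerColor≡ bt b₀ e)) e₀) , t∈u
        where
        bt : blockOf T t ≡ u
        bt = inBlockAt⇒blockOf T t∈u
      from : ∀ {t} → S t × InBlockAt T u t → (I (tensor T) t × InBlockAt T u t) × τAt u t ≡ τAt u s₀
      from {t} ((It , e) , t∈u) =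
        (It , t∈u) ,
        innerColor≡⇒τAt≡ (inBlockAt⇒blockOf T t∈u) b₀
          (productColor≡⇒innerColor≡ (trans e (sym e₀)))

mainTheorem7 : ∀ {a b c} (T : BlockColoredTensor a b c) (χT χO : ℕ)
                 (χI : Fin (p T) → Fin (q T) → Fin (r T) → ℕ) →
                 IsChi (tensor T) χT →
                 IsChi (Out T) χO →
                 (∀ i j k → IsChi (Inn T i j k) (χI i j k)) →
                 χT ≤ χO * max3 (p T) (q T) (r T) χI
mainTheorem7 T χT χO χI (_ , χT-minimal) ((σ , σ-valid) , _) innerChi =
  χT-minimal _ (productColor , productColor-valid)
  where
  open ProductColoring T σ σ-valid (λ i j k → proj₁ (proj₁ (innerChi i j k)))
                       (λ i j k → proj₂ (proj₁ (innerChi i j k))) (≤max3 (p T) (q T) (r T) χI)
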